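{- With $h(x,y,z)=(x\mathbin{\wedge_\bullet}y)\mathbin{\vee_\bullet}(\neg x\mathbin{\wedge_\bullet}z)$, the equation $h(x,\ h(y,z,u),\ h(y,v,w))=h(y,\ h(x,z,v),\ h(x,u,w))$ (variables $x,y,z,u,v,w$) is derivable in equational logic from $\mathrm{EqC\ell FEL}_2$.
   Context: Terms are built from variables, $\mathsf T,\mathsf F$, atoms, $\neg$, $\mathbin{\wedge_\bullet}$, $\mathbin{\vee_\bullet}$. $\mathrm{EqC\ell FEL}_2$ consists of: $\mathsf F=\neg\mathsf T$; $x\mathbin{\vee_\bullet}y=\neg(\neg x\mathbin{\wedge_\bullet}\neg y)$; $\neg\neg x=x$; $(x\mathbin{\wedge_\bullet}y)\mathbin{\wedge_\bullet}z=x\mathbin{\wedge_\bullet}(y\mathbin{\wedge_\bullet}z)$; $\mathsf T\mathbin{\wedge_\bullet}x=x$; $x\mathbin{\wedge_\bullet}\mathsf T=x$; $x\mathbin{\wedge_\bullet}\mathsf F=\mathsf F\mathbin{\wedge_\bullet}x$; $\neg x\mathbin{\wedge_\bullet}\mathsf F=x\mathbin{\wedge_\bullet}\mathsf F$; $(x\mathbin{\wedge_\bullet}\mathsf F)\mathbin{\vee_\bullet}y=(x\mathbin{\vee_\bullet}\mathsf T)\mathbin{\wedge_\bullet}y$; $x\mathbin{\vee_\bullet}(y\mathbin{\wedge_\bullet}\mathsf F)=x\mathbin{\wedge_\bullet}(y\mathbin{\vee_\bullet}\mathsf T)$; $(x\mathbin{\vee_\bullet}y)\mathbin{\wedge_\bullet}z=(\neg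 x\mathbin{\wedge_\bullet}(y\mathbin{\wedge_\bullet}z))\mathbin{\vee_\bullet}(x\mathbin{\wedge_\bullet}z)$; $x\mathbin{\wedge_\bullet}y=y\mathbin{\wedge_\bullet}x$. -}

module Defs where

open import Data.Nat using (ℕ)

data Term (A : Set) : Set where
  var  : ℕ → Term A
  𝐓 𝐅  : Term A
  atom : A → Term A
  ¬_   : Term A → Term A
  _∧_  : Term A → Term A → Term A   -- left-sequential conjunction ∧•
  _∨_  : Term A → Term A → Term A   -- left-sequential disjunction ∨•

infix  9 ¬_
infixr 7 _∧_
infixr 6 _∨_

_[_] : {A : Set} → Term A → (ℕ → Term A) → Term A
var n   [ σ ] = σ n
𝐓       [ σ ] = 𝐓
𝐅       [ σ ] = 𝐅
atom a  [ σ ] = atom a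
(¬ t)   [ σ ] = ¬ (t [ σ ])
(s ∧ t) [ σ ] = (s [ σ ]) ∧ (t [ σ ])
(s ∨ t) [ σ ] = (s [ σ ]) ∨ (t [ σ ])

module _ {A : Set} where
  private
    x y z : Term A
    x = var 0
    y = var 1
    z = var 2

  data EqCℓFEL₂ : Term A → Term A → Set where
    ax1  : EqCℓFEL₂ 𝐅 (¬ 𝐓)
    ax2  : EqCℓFEL₂ (x ∨ y) (¬ ((¬ x) ∧ (¬ y)))
    ax3  : EqCℓFEL₂ (¬ (¬ x)) x
    ax4  : EqCℓFEL₂ ((x ∧ y) ∧ z) (x ∧ (y ∧ z))
    ax5  : EqCℓFEL₂ (𝐓 ∧ x) x
    ax6  : EqCℓFEL₂ (x ∧ 𝐓) x
    ax7  : EqCℓFEL₂ (x ∧ 𝐅) (𝐅 ∧ x)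
    ax8  : EqCℓFEL₂ ((¬ x) ∧ 𝐅) (x ∧ 𝐅)
    ax9  : EqCℓFEL₂ ((x ∧ 𝐅) ∨ y) ((x ∨ 𝐓) ∧ y)
    ax10 : EqCℓFEL₂ (x ∨ (y ∧ 𝐅)) (x ∧ (y ∨ 𝐓))
    ax11 : EqCℓFEL₂ ((x ∨ y) ∧ z) (((¬ x) ∧ (y ∧ z)) ∨ (x ∧ z))
    ax12 : EqCℓFEL₂ (x ∧ y) (y ∧ x)

  infix 4 _≃_
  data _≃_ : Term A → Term A → Set where
    ax    : ∀ {l r} → EqCℓFEL₂ l r → (σ : ℕ → Term A) → (l [ σ ]) ≃ (r [ σ ])
    refl  : ∀ {t} → t ≃ t
    sym   : ∀ {s t} → s ≃ t → t ≃ s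
    trans : ∀ {s t u} → s ≃ t → t ≃ u → s ≃ u
    cong¬ : ∀ {s t} → s ≃ t → (¬ s) ≃ (¬ t)
    cong∧ : ∀ {s s′ t t′} → s ≃ s′ → t ≃ t′ → (s ∧ t) ≃ (s′ ∧ t′)
    cong∨ : ∀ {s s′ t t′} → s ≃ s′ → t ≃ t′ → (s ∨ t) ≃ (s′ ∨ t′)

h : {A : Set} → Term A → Term A → Term A → Term A
h x y z = (x ∧ y) ∨ ((¬ x) ∧ z)

-- Once EqCℓFEL₂ is shown to prove that ∧• and ∨• are commutative and
-- associative with ∧• distributing over ∨• on both sides, both sides of the
-- equation expand to four disjuncts of the form ±x ∧• ±y ∧• t; they agree up to
-- swapping the two outer conjuncts and the two middle disjuncts.
module Submission where

open import Data.Nat using (ℕ)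
open import Relation.Binary.Bundles using (Setoid)
open import Relation.Binary.Structures using (IsEquivalence)
open import Defs

module _ {A : Set} where

  ≃-isEquivalence : IsEquivalence (_≃_ {A})
  ≃-isEquivalence = record { refl = refl ; sym = sym ; trans = trans }

  ≃-setoid : Setoid _ _
  ≃-setoid = record { isEquivalence = ≃-isEquivalence }

  open import Relation.Binary.Reasoning.Setoid ≃-setoid

  σ₃ : Term A → Term A → Term A → ℕ → Term A
  σ₃ a b c 0 = a
  σ₃ a b c 1 = b
  σ₃ a b c _ = c

  F≃¬T : 𝐅 ≃ ¬ 𝐓
  F≃¬T = ax ax1 (σ₃ 𝐓 𝐓 𝐓)

  ∨-defn : ∀ a b → (a ∨ b) ≃ ¬ (¬ a ∧ ¬ b)
  ∨-defn a b = ax ax2 (σ₃ a b 𝐓)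

  ¬-involutive : ∀ a → ¬ ¬ a ≃ a
  ¬-involutive a = ax ax3 (σ₃ a 𝐓 𝐓)

  ∧-assoc : ∀ a b c → ((a ∧ b) ∧ c) ≃ (a ∧ (b ∧ c))
  ∧-assoc a b c = ax ax4 (σ₃ a b c)

  ∧-identityʳ : ∀ a → (a ∧ 𝐓) ≃ a
  ∧-identityʳ a = ax ax6 (σ₃ a 𝐓 𝐓)

  ¬-∧F : ∀ a → (¬ a ∧ 𝐅) ≃ (a ∧ 𝐅)
  ¬-∧F a = ax ax8 (σ₃ a 𝐓 𝐓)

  ∧F-∨ : ∀ a b → ((a ∧ 𝐅) ∨ b) ≃ ((a ∨ 𝐓) ∧ b)
  ∧F-∨ a b = ax ax9 (σ₃ a b 𝐓)

  ∨-∧-unfold : ∀ a b c → ((a ∨ b) ∧ c) ≃ ((¬ a ∧ (b ∧ c)) ∨ (a ∧ c))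
  ∨-∧-unfold a b c = ax ax11 (σ₃ a b c)

  ∧-comm : ∀ a b → (a ∧ b) ≃ (b ∧ a)
  ∧-comm a b = ax ax12 (σ₃ a b 𝐓)

  ∧-congˡ : ∀ {a a′ b : Term A} → a ≃ a′ → (a ∧ b) ≃ (a′ ∧ b)
  ∧-congˡ p = cong∧ p refl

  ∧-congʳ : ∀ {a b b′ : Term A} → b ≃ b′ → (a ∧ b) ≃ (a ∧ b′)
  ∧-congʳ p = cong∧ refl p

  ∨-congˡ : ∀ {a a′ b : Term A} → a ≃ a′ → (a ∨ b) ≃ (a′ ∨ b)
  ∨-congˡ p = cong∨ p refl

  ∨-congʳ : ∀ {a b b′ : Term A} → b ≃ b′ → (a ∨ b) ≃ (a ∨ b′)
  ∨-congʳ p = cong∨ refl p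

  ¬-injective : ∀ {a b : Term A} → ¬ a ≃ ¬ b → a ≃ b
  ¬-injective {a} {b} p = begin
    a     ≈⟨ ¬-involutive a ⟨
    ¬ ¬ a ≈⟨ cong¬ p ⟩
    ¬ ¬ b ≈⟨ ¬-involutive b ⟩
    b     ∎

  ¬F≃T : ¬ 𝐅 ≃ 𝐓
  ¬F≃T = trans (cong¬ F≃¬T) (¬-involutive 𝐓)

  ¬-distrib-∨ : ∀ a b → ¬ (a ∨ b) ≃ (¬ a ∧ ¬ b)
  ¬-distrib-∨ a b = trans (cong¬ (∨-defn a b)) (¬-involutive _)

  ¬-distrib-∧ : ∀ a b → ¬ (a ∧ b) ≃ (¬ a ∨ ¬ b)
  ¬-distrib-∧ a b = begin
    ¬ (a ∧ b)         ≈⟨ cong¬ (cong∧ (¬-involutive a) (¬-involutive b)) ⟨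
    ¬ (¬ ¬ a ∧ ¬ ¬ b) ≈⟨ ∨-defn (¬ a) (¬ b) ⟨
    ¬ a ∨ ¬ b         ∎

  ∨-comm : ∀ a b → (a ∨ b) ≃ (b ∨ a)
  ∨-comm a b = begin
    a ∨ b           ≈⟨ ∨-defn a b ⟩
    ¬ (¬ a ∧ ¬ b)   ≈⟨ cong¬ (∧-comm (¬ a) (¬ b)) ⟩
    ¬ (¬ b ∧ ¬ a)   ≈⟨ ∨-defn b a ⟨
    b ∨ a           ∎

  ∨-assoc : ∀ a b c → ((a ∨ b) ∨ c) ≃ (a ∨ (b ∨ c))
  ∨-assoc a b c = begin
    (a ∨ b) ∨ c           ≈⟨ ∨-defn _ _ ⟩
    ¬ (¬ (a ∨ b) ∧ ¬ c)   ≈⟨ cong¬ (∧-congˡ (¬-distrib-∨ a b)) ⟩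
    ¬ ((¬ a ∧ ¬ b) ∧ ¬ c) ≈⟨ cong¬ (∧-assoc _ _ _) ⟩
    ¬ (¬ a ∧ (¬ b ∧ ¬ c)) ≈⟨ cong¬ (∧-congʳ (¬-distrib-∨ b c)) ⟨
    ¬ (¬ a ∧ ¬ (b ∨ c))   ≈⟨ ∨-defn _ _ ⟨
    a ∨ (b ∨ c)           ∎

  ∨-interchange : ∀ a b c d → ((a ∨ b) ∨ (c ∨ d)) ≃ ((a ∨ c) ∨ (b ∨ d))
  ∨-interchange a b c d = begin
    (a ∨ b) ∨ (c ∨ d) ≈⟨ ∨-assoc _ _ _ ⟩
    a ∨ (b ∨ (c ∨ d)) ≈⟨ ∨-congʳ (∨-assoc _ _ _) ⟨
    a ∨ ((b ∨ c) ∨ d) ≈⟨ ∨-congʳ (∨-congˡ (∨-comm b c)) ⟩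
    a ∨ ((c ∨ b) ∨ d) ≈⟨ ∨-congʳ (∨-assoc _ _ _) ⟩
    a ∨ (c ∨ (b ∨ d)) ≈⟨ ∨-assoc _ _ _ ⟨
    (a ∨ c) ∨ (b ∨ d) ∎

  ∧-swap : ∀ a b c → (a ∧ (b ∧ c)) ≃ (b ∧ (a ∧ c))
  ∧-swap a b c = begin
    a ∧ (b ∧ c) ≈⟨ ∧-assoc _ _ _ ⟨
    (a ∧ b) ∧ c ≈⟨ ∧-congˡ (∧-comm a b) ⟩
    (b ∧ a) ∧ c ≈⟨ ∧-assoc _ _ _ ⟩
    b ∧ (a ∧ c) ∎

  ∨-identityʳ : ∀ a → (a ∨ 𝐅) ≃ a
  ∨-identityʳ a = begin
    a ∨ 𝐅         ≈⟨ ∨-defn a 𝐅 ⟩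
    ¬ (¬ a ∧ ¬ 𝐅) ≈⟨ cong¬ (∧-congʳ ¬F≃T) ⟩
    ¬ (¬ a ∧ 𝐓)   ≈⟨ cong¬ (∧-identityʳ _) ⟩
    ¬ ¬ a         ≈⟨ ¬-involutive a ⟩
    a             ∎

  ∨T≃¬∧F : ∀ a → (a ∨ 𝐓) ≃ ¬ (a ∧ 𝐅)
  ∨T≃¬∧F a = begin
    a ∨ 𝐓         ≈⟨ ∨-defn a 𝐓 ⟩
    ¬ (¬ a ∧ ¬ 𝐓) ≈⟨ cong¬ (∧-congʳ F≃¬T) ⟨
    ¬ (¬ a ∧ 𝐅)   ≈⟨ cong¬ (¬-∧F a) ⟩
    ¬ (a ∧ 𝐅)     ∎

  ¬-∨T : ∀ a → (¬ a ∨ 𝐓) ≃ (a ∨ 𝐓)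
  ¬-∨T a = begin
    ¬ a ∨ 𝐓     ≈⟨ ∨T≃¬∧F (¬ a) ⟩
    ¬ (¬ a ∧ 𝐅) ≈⟨ cong¬ (¬-∧F a) ⟩
    ¬ (a ∧ 𝐅)   ≈⟨ ∨T≃¬∧F a ⟨
    a ∨ 𝐓       ∎

  ∨-unfold : ∀ a b → (a ∨ b) ≃ ((¬ a ∧ b) ∨ a)
  ∨-unfold a b = begin
    a ∨ b                                ≈⟨ ∧-identityʳ _ ⟨
    (a ∨ b) ∧ 𝐓                          ≈⟨ ∨-∧-unfold a b 𝐓 ⟩
    (¬ a ∧ (b ∧ 𝐓)) ∨ (a ∧ 𝐓)            ≈⟨ cong∨ (∧-congʳ (∧-identityʳ b)) (∧-identityʳ a) ⟩
    (¬ a ∧ b) ∨ a                        ∎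

  ∨T-∧-absorb : ∀ a → ((a ∨ 𝐓) ∧ a) ≃ a
  ∨T-∧-absorb a = begin
    (a ∨ 𝐓) ∧ a     ≈⟨ ∧-congˡ (¬-∨T a) ⟨
    (¬ a ∨ 𝐓) ∧ a   ≈⟨ ∧F-∨ (¬ a) a ⟨
    (¬ a ∧ 𝐅) ∨ a   ≈⟨ ∨-unfold a 𝐅 ⟨
    a ∨ 𝐅           ≈⟨ ∨-identityʳ a ⟩
    a               ∎

  excluded-middle : ∀ a → (a ∨ ¬ a) ≃ ¬ (a ∧ 𝐅)
  excluded-middle a = begin
    a ∨ ¬ a                         ≈⟨ cong∨ (trans (∧-identityʳ _) (¬-involutive a)) (∧-identityʳ _) ⟨
    (¬ ¬ a ∧ 𝐓) ∨ (¬ a ∧ 𝐓)         ≈⟨ ∨-congˡ (∧-congʳ (∧-identityʳ 𝐓)) ⟨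
    (¬ ¬ a ∧ (𝐓 ∧ 𝐓)) ∨ (¬ a ∧ 𝐓)   ≈⟨ ∨-∧-unfold (¬ a) 𝐓 𝐓 ⟨
    (¬ a ∨ 𝐓) ∧ 𝐓                   ≈⟨ ∧-identityʳ _ ⟩
    ¬ a ∨ 𝐓                         ≈⟨ ¬-∨T a ⟩
    a ∨ 𝐓                           ≈⟨ ∨T≃¬∧F a ⟩
    ¬ (a ∧ 𝐅)                       ∎

  ¬x∧x≃x∧F : ∀ a → (¬ a ∧ a) ≃ (a ∧ 𝐅)
  ¬x∧x≃x∧F a = ¬-injective (begin
    ¬ (¬ a ∧ a)     ≈⟨ cong¬ (∧-congʳ (¬-involutive a)) ⟨
    ¬ (¬ a ∧ ¬ ¬ a) ≈⟨ ∨-defn a (¬ a) ⟨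
    a ∨ ¬ a         ≈⟨ excluded-middle a ⟩
    ¬ (a ∧ 𝐅)       ∎)

  ¬-∧-∧F : ∀ a b → (¬ a ∧ (b ∧ 𝐅)) ≃ (a ∧ (b ∧ 𝐅))
  ¬-∧-∧F a b = begin
    ¬ a ∧ (b ∧ 𝐅) ≈⟨ ∧-congʳ (∧-comm _ _) ⟩
    ¬ a ∧ (𝐅 ∧ b) ≈⟨ ∧-assoc _ _ _ ⟨
    (¬ a ∧ 𝐅) ∧ b ≈⟨ ∧-congˡ (¬-∧F a) ⟩
    (a ∧ 𝐅) ∧ b   ≈⟨ ∧-assoc _ _ _ ⟩
    a ∧ (𝐅 ∧ b)   ≈⟨ ∧-congʳ (∧-comm _ _) ⟩
    a ∧ (b ∧ 𝐅)   ∎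

  ¬∧-∧ : ∀ a b → (¬ (a ∧ b) ∧ b) ≃ (¬ a ∧ b)
  ¬∧-∧ a b = begin
    ¬ (a ∧ b) ∧ b                      ≈⟨ ∧-congˡ (¬-distrib-∧ a b) ⟩
    (¬ a ∨ ¬ b) ∧ b                    ≈⟨ ∨-∧-unfold _ _ _ ⟩
    (¬ ¬ a ∧ (¬ b ∧ b)) ∨ (¬ a ∧ b)    ≈⟨ ∨-congˡ (cong∧ (¬-involutive a) (¬x∧x≃x∧F b)) ⟩
    (a ∧ (b ∧ 𝐅)) ∨ (¬ a ∧ b)          ≈⟨ ∨-congˡ (∧-assoc _ _ _) ⟨
    ((a ∧ b) ∧ 𝐅) ∨ (¬ a ∧ b)          ≈⟨ ∧F-∨ _ _ ⟩
    ((a ∧ b) ∨ 𝐓) ∧ (¬ a ∧ b)          ≈⟨ ∧-congˡ ∨T-equal ⟩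
    ((¬ a ∧ b) ∨ 𝐓) ∧ (¬ a ∧ b)        ≈⟨ ∨T-∧-absorb _ ⟩
    ¬ a ∧ b                            ∎
    where
    ∨T-equal : ((a ∧ b) ∨ 𝐓) ≃ ((¬ a ∧ b) ∨ 𝐓)
    ∨T-equal = begin
      (a ∧ b) ∨ 𝐓       ≈⟨ ∨T≃¬∧F _ ⟩
      ¬ ((a ∧ b) ∧ 𝐅)   ≈⟨ cong¬ (∧-assoc _ _ _) ⟩
      ¬ (a ∧ (b ∧ 𝐅))   ≈⟨ cong¬ (¬-∧-∧F a b) ⟨
      ¬ (¬ a ∧ (b ∧ 𝐅)) ≈⟨ cong¬ (∧-assoc _ _ _) ⟨
      ¬ ((¬ a ∧ b) ∧ 𝐅) ≈⟨ ∨T≃¬∧F _ ⟨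
      (¬ a ∧ b) ∨ 𝐓     ∎

  -- Axiom 11 guards b ∧ c by ¬ a; inside a conjunction ending in c that guard
  -- may be strengthened to ¬ (a ∧ c), and then ∨-unfold folds the disjunction back.
  ∧-distribʳ-∨ : ∀ a b c → ((a ∨ b) ∧ c) ≃ ((a ∧ c) ∨ (b ∧ c))
  ∧-distribʳ-∨ a b c = begin
    (a ∨ b) ∧ c                        ≈⟨ ∨-∧-unfold _ _ _ ⟩
    (¬ a ∧ (b ∧ c)) ∨ (a ∧ c)          ≈⟨ ∨-congˡ guard ⟩
    (¬ (a ∧ c) ∧ (b ∧ c)) ∨ (a ∧ c)    ≈⟨ ∨-unfold _ _ ⟨
    (a ∧ c) ∨ (b ∧ c)                  ∎
    where
    guard : (¬ a ∧ (b ∧ c)) ≃ (¬ (a ∧ c) ∧ (b ∧ c))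
    guard = begin
      ¬ a ∧ (b ∧ c)         ≈⟨ ∧-swap _ _ _ ⟩
      b ∧ (¬ a ∧ c)         ≈⟨ ∧-congʳ (¬∧-∧ a c) ⟨
      b ∧ (¬ (a ∧ c) ∧ c)   ≈⟨ ∧-swap _ _ _ ⟩
      ¬ (a ∧ c) ∧ (b ∧ c)   ∎

  ∧-distribˡ-∨ : ∀ a b c → (a ∧ (b ∨ c)) ≃ ((a ∧ b) ∨ (a ∧ c))
  ∧-distribˡ-∨ a b c = begin
    a ∧ (b ∨ c)       ≈⟨ ∧-comm _ _ ⟩
    (b ∨ c) ∧ a       ≈⟨ ∧-distribʳ-∨ b c a ⟩
    (b ∧ a) ∨ (c ∧ a) ≈⟨ cong∨ (∧-comm b a) (∧-comm c a) ⟩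
    (a ∧ b) ∨ (a ∧ c) ∎

  h-expand : ∀ x y z u v w →
    h x (h y z u) (h y v w) ≃
      ((x ∧ (y ∧ z)) ∨ (¬ x ∧ (y ∧ v))) ∨ ((x ∧ (¬ y ∧ u)) ∨ (¬ x ∧ (¬ y ∧ w)))
  h-expand x y z u v w = begin
    h x (h y z u) (h y v w)
      ≈⟨ cong∨ (∧-distribˡ-∨ _ _ _) (∧-distribˡ-∨ _ _ _) ⟩
    ((x ∧ (y ∧ z)) ∨ (x ∧ (¬ y ∧ u))) ∨ ((¬ x ∧ (y ∧ v)) ∨ (¬ x ∧ (¬ y ∧ w)))
      ≈⟨ ∨-interchange _ _ _ _ ⟩
    ((x ∧ (y ∧ z)) ∨ (¬ x ∧ (y ∧ v))) ∨ ((x ∧ (¬ y ∧ u)) ∨ (¬ x ∧ (¬ y ∧ w)))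
      ∎

  h-comm : ∀ x y z u v w → h x (h y z u) (h y v w) ≃ h y (h x z v) (h x u w)
  h-comm x y z u v w = begin
    h x (h y z u) (h y v w)
      ≈⟨ h-expand x y z u v w ⟩
    ((x ∧ (y ∧ z)) ∨ (¬ x ∧ (y ∧ v))) ∨ ((x ∧ (¬ y ∧ u)) ∨ (¬ x ∧ (¬ y ∧ w)))
      ≈⟨ cong∨ (cong∨ (∧-swap _ _ _) (∧-swap _ _ _)) (cong∨ (∧-swap _ _ _) (∧-swap _ _ _)) ⟩
    ((y ∧ (x ∧ z)) ∨ (y ∧ (¬ x ∧ v))) ∨ ((¬ y ∧ (x ∧ u)) ∨ (¬ y ∧ (¬ x ∧ w)))
      ≈⟨ cong∨ (∧-distribˡ-∨ _ _ _) (∧-distribˡ-∨ _ _ _) ⟨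
    h y (h x z v) (h x u w)
      ∎

lemma6p8 : {A : Set} →
    h {A} (var 0) (h (var 1) (var 2) (var 3)) (h (var 1) (var 4) (var 5))
      ≃ h {A} (var 1) (h (var 0) (var 2) (var 4)) (h (var 0) (var 3) (var 5))
lemma6p8 = h-comm (var 0) (var 1) (var 2) (var 3) (var 4) (var 5)
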